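{- For each ground type $\gamma$ there is a quadratic function $q_\gamma$ such that for every type-$\gamma$ value $v$ and every $\mathsf{vtg}$-value $L$ that represents $v$, $\mathrm{size}(L)\le q_\gamma(\mathrm{size}(v))$.
   Context: Ground types are built from $\mathsf{unit}$ and inductive data types $\mu P$ ($P$ a polynomial functor from $\mathrm{Id}$, constant functors, $+,\times$; $\mu P$ its least fixed point) by $+,\times$. Values are rooted labelled dags with vertices labelled $\underline{()}$, $\underline\iota_j$, pair, or $\underline{\mathsf c}_{\mu P}$, with sharing; $\mathrm{size}(v)$ = number of $\underline{\mathsf c}_{\mu P}$-labelled vertices. $\mathsf{nat}=\mu(\mathsf C_{\mathsf{unit}}+\mathrm{Id})$, $\mathsf{string}$ is a data type of strings (over a fixed finite alphabet), $\ulcorner\gamma\urcorner$ is a fixed string encoding of type $\gamma$. $\mathsf{vtg}=\mathsf{list}_{\mathsf{vertex}}$ where $\mathsf{vertex}$ has constructors $\mathsf{Vert}_{()}$, $\mathsf{Vert}_{\iota_1},\mathsf{Vert}_{\iota_2}$ of $\mathsf{string}\times\mathsf{nat}$, $\mathsf{Vert}_{(,)}$ of $\mathsf{string}\times\mathsf{nat}\times\mathsf{nat}$, $\mathsf{Vert}_\mu$ of $\mathsf{string}\times\mathsf{nat}$. For $L=[u_{n-1},\dots,u_0]$, $u_i$ has address $i$. $L$ represents $v$ iff there is a bijection between vertices of $v$ and items of $L$ such that $\underline{()}\mapsto\mathsf{Vert}_{()}$; a pair vertex of type $\gamma_1\times\gamma_2$ with children $v_1,v_2\mapsto\mathsf{Vert}_{(,)}(\ulcorner\gamma_1\times\gamma_2\urcorner,a_1,a_2)$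 with $a_j$ the address of $v_j$'s item (as a numeral); an $\underline\iota_j$-vertex of type $\gamma_1+\gamma_2$ with child $v_j\mapsto\mathsf{Vert}_{\iota_j}(\ulcorner\gamma_1+\gamma_2\urcorner,a_j)$; a $\underline{\mathsf c}_{\mu P}$-vertex with child $v_0\mapsto\mathsf{Vert}_\mu(\ulcorner\mu P\urcorner,a_0)$; and the item order is a topological sort of $v$. -}

module Defs where

open import Data.Nat using (ℕ; zero; suc; _+_; _*_; _<_; _≤_)
open import Data.Fin using (Fin; zero; suc; toℕ)
open import Data.List using (List; []; _∷_; length; map; reverse; lookup)
open import Data.List.Membership.Propositional using (_∈_)
open import Data.List.Relation.Unary.Any using (here; there; index)
open import Data.Product using (Σ; _×_; _,_)
open import Function.Bundles using (_⤖_; Bijection)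
open import Relation.Binary.PropositionalEquality using (_≡_; refl)

data GType : Set
data Poly : Set

data GType where
  unit : GType
  _⊕_  : GType → GType → GType
  _⊗_  : GType → GType → GType
  μ    : Poly → GType

data Poly where
  Id  : Poly
  C   : GType → Poly
  _⊞_ : Poly → Poly → Poly
  _⊠_ : Poly → Poly → Poly

infixr 5 _⊕_ _⊞_
infixr 6 _⊗_ _⊠_

app : Poly → GType → GType
app Id      X = X
app (C γ)   X = γ
app (P ⊞ Q) X = app P X ⊕ app Q X
app (P ⊠ Q) X = app P X ⊗ app Q X

-- Values as rooted labelled dags with sharing.
-- A dag is given by listing its vertices so that every vertex only points
-- to vertices listed before it (acyclicity); the context Γ records the type
-- of each vertex (head = most recently added vertex).

data Node (Γ : List GType) : GType → Set where
  nUnit : Node Γ unit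
  nInl  : ∀ {a b} → a ∈ Γ → Node Γ (a ⊕ b)
  nInr  : ∀ {a b} → b ∈ Γ → Node Γ (a ⊕ b)
  nPair : ∀ {a b} → a ∈ Γ → b ∈ Γ → Node Γ (a ⊗ b)
  nCon  : ∀ {P} → app P (μ P) ∈ Γ → Node Γ (μ P)

data Graph : List GType → Set where
  []  : Graph []
  _▷_ : ∀ {Γ γ} → Graph Γ → Node Γ γ → Graph (γ ∷ Γ)

data Info (n : ℕ) : Set where
  iU : Info n
  iL : GType → GType → Fin n → Info n
  iR : GType → GType → Fin n → Info n
  iP : GType → GType → Fin n → Fin n → Info n
  iC : Poly → Fin n → Info n

shiftInfo : ∀ {n} → Info n → Info (suc n)
shiftInfo iU           = iU
shiftInfo (iL a b c)   = iL a b (suc c)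
shiftInfo (iR a b c)   = iR a b (suc c)
shiftInfo (iP a b c d) = iP a b (suc c) (suc d)
shiftInfo (iC P c)     = iC P (suc c)

nodeInfo₀ : ∀ {Γ γ} → Node Γ γ → Info (length Γ)
nodeInfo₀ nUnit                     = iU
nodeInfo₀ (nInl {a} {b} m)          = iL a b (index m)
nodeInfo₀ (nInr {a} {b} m)          = iR a b (index m)
nodeInfo₀ (nPair {a} {b} m₁ m₂)     = iP a b (index m₁) (index m₂)
nodeInfo₀ (nCon {P} m)              = iC P (index m)

nodeInfo : ∀ {Γ} → Graph Γ → Fin (length Γ) → Info (length Γ)
nodeInfo (g ▷ x) zero    = shiftInfo (nodeInfo₀ x)
nodeInfo (g ▷ x) (suc i) = shiftInfo (nodeInfo g i)

children : ∀ {n} → Info n → List (Fin n)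
children iU           = []
children (iL _ _ c)   = c ∷ []
children (iR _ _ c)   = c ∷ []
children (iP _ _ c d) = c ∷ d ∷ []
children (iC _ c)     = c ∷ []

data Reach {Γ} (g : Graph Γ) (r : Fin (length Γ)) : Fin (length Γ) → Set where
  start : Reach g r r
  step  : ∀ {u w} → Reach g r u → w ∈ children (nodeInfo g u) → Reach g r w

sizeG : ∀ {Γ} → Graph Γ → ℕ
sizeG []             = 0
sizeG (g ▷ nCon _)   = suc (sizeG g)
sizeG (g ▷ nUnit)    = sizeG g
sizeG (g ▷ nInl _)   = sizeG g
sizeG (g ▷ nInr _)   = sizeG g
sizeG (g ▷ nPair _ _) = sizeG g

record Value (γ : GType) : Set where
  constructor value
  field
    ctx    : List GType
    graph  : Graph ctx
    root   : γ ∈ ctx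
    rooted : ∀ w → Reach graph (index root) w

size : ∀ {γ} → Value γ → ℕ
size v = sizeG (Value.graph v)

data Val : GType → Set where
  ⟨⟩   : Val unit
  inl  : ∀ {a b} → Val a → Val (a ⊕ b)
  inr  : ∀ {a b} → Val b → Val (a ⊕ b)
  pair : ∀ {a b} → Val a → Val b → Val (a ⊗ b)
  con  : ∀ {P} → Val (app P (μ P)) → Val (μ P)

unfoldG    : ∀ {Γ γ} → Graph Γ → γ ∈ Γ → Val γ
unfoldNode : ∀ {Γ γ} → Graph Γ → Node Γ γ → Val γ
unfoldG (g ▷ x) (here refl) = unfoldNode g x
unfoldG (g ▷ x) (there m)   = unfoldG g m
unfoldNode g nUnit         = ⟨⟩
unfoldNode g (nInl m)      = inl (unfoldG g m)
unfoldNode g (nInr m)      = inr (unfoldG g m)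
unfoldNode g (nPair m₁ m₂) = pair (unfoldG g m₁) (unfoldG g m₂)
unfoldNode g (nCon m)      = con (unfoldG g m)

unfoldV : ∀ {γ} → Value γ → Val γ
unfoldV v = unfoldG (Value.graph v) (Value.root v)

-- Specific data types.  The alphabet has (suc k) letters.

charT : ℕ → GType
charT zero    = unit
charT (suc k) = unit ⊕ charT k

listT : GType → GType
listT α = μ (C unit ⊞ (C α ⊠ Id))

natT : GType
natT = μ (C unit ⊞ Id)

stringT : ℕ → GType
stringT k = listT (charT k)

-- constructors Vert_(), Vert_ι₁, Vert_ι₂, Vert_(,), Vert_μ (in this order)
vertexT : ℕ → GType
vertexT k = μ (C unit ⊞ (C (stringT k ⊗ natT) ⊞ (C (stringT k ⊗ natT)
              ⊞ (C (stringT k ⊗ (natT ⊗ natT)) ⊞ C (stringT k ⊗ natT)))))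

vtgT : ℕ → GType
vtgT k = listT (vertexT k)

toNat : Val natT → ℕ
toNat (con (inl ⟨⟩)) = zero
toNat (con (inr n))  = suc (toNat n)

toList : ∀ {α} → Val (listT α) → List (Val α)
toList (con (inl ⟨⟩))          = []
toList (con (inr (pair x xs))) = x ∷ toList xs

data Item (k : ℕ) : Set where
  vUnit : Item k
  vInl  : Val (stringT k) → ℕ → Item k
  vInr  : Val (stringT k) → ℕ → Item k
  vPair : Val (stringT k) → ℕ → ℕ → Item k
  vMu   : Val (stringT k) → ℕ → Item k

toItem : ∀ {k} → Val (vertexT k) → Item k
toItem (con (inl ⟨⟩))                                  = vUnit
toItem (con (inr (inl (pair s a))))                    = vInl s (toNat a)
toItem (con (inr (inr (inl (pair s a)))))              = vInr s (toNat a)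
toItem (con (inr (inr (inr (inl (pair s (pair a b))))))) = vPair s (toNat a) (toNat b)
toItem (con (inr (inr (inr (inr (pair s a))))))        = vMu s (toNat a)

-- items of L indexed by address: position i holds u_i
-- (L = [u_{n-1}, …, u_0], so we reverse)
itemsByAddr : ∀ {k} → Value (vtgT k) → List (Item k)
itemsByAddr L = reverse (map toItem (toList (unfoldV L)))

expected : ∀ {k n m} → (GType → Val (stringT k)) → (Fin n → Fin m) → Info n → Item k
expected enc f iU           = vUnit
expected enc f (iL a b c)   = vInl (enc (a ⊕ b)) (toℕ (f c))
expected enc f (iR a b c)   = vInr (enc (a ⊕ b)) (toℕ (f c))
expected enc f (iP a b c d) = vPair (enc (a ⊗ b)) (toℕ (f c)) (toℕ (f d))
expected enc f (iC P c)     = vMu (enc (μ P)) (toℕ (f c))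

Represents : ∀ k → (GType → Val (stringT k)) → ∀ {γ} → Value γ → Value (vtgT k) → Set
Represents k enc v L =
  Σ (Fin (length (Value.ctx v)) ⤖ Fin (length (itemsByAddr L))) λ β →
    (∀ w → lookup (itemsByAddr L) (Bijection.to β w)
             ≡ expected enc (Bijection.to β) (nodeInfo (Value.graph v) w))
    × (∀ u w → w ∈ children (nodeInfo (Value.graph v) u)
             → toℕ (Bijection.to β w) < toℕ (Bijection.to β u))

-- Every vertex of a value of type γ has its type in closure γ, a finite list closed under
-- taking components.  Hence, with K = Σ shallowSize over closure γ, each vertex reaches at
-- most K vertices before crossing a constructor vertex, so a value with s constructor
-- vertices has n ≤ K (s + 1) vertices.  A list L representing v has one item per vertex,
-- and an item costs at most 2 + E + 2n constructors, E bounding the encodings of the types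
-- in closure γ and the two addresses being below n.  Since the constructors of the dag of
-- L are at most those of its tree unfolding, size L ≤ 1 + n (2 + E + 2n).
{-# OPTIONS --safe #-}
module Submission where

open import Defs
open import Data.Fin using (Fin; zero; suc; toℕ)
open import Data.Fin.Properties using (toℕ<n; injective⇒≤)
open import Data.List using (List; []; _∷_; _++_; length; map; lookup; reverse)
open import Data.List.Membership.Propositional using (_∈_)
open import Data.List.Membership.Propositional.Properties using (∈-map⁺; ∈-map⁻)
open import Data.List.Properties using (map-++; length-map; length-reverse)
open import Data.List.Relation.Binary.Subset.Propositional using (_⊆_)
open import Data.List.Relation.Binary.Subset.Propositional.Properties
  using (∈-∷⁺ʳ) renaming (++⁺ˡ to ⊆-++⁺ˡ)
open import Data.List.Relation.Unary.Any as Any using (Any; here; there; index)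
open import Data.List.Relation.Unary.Any.Properties
  using (lookup-index; reverse⁺; ++⁺ˡ; ++⁺ʳ; ++⁻)
open import Data.Nat using (ℕ; zero; suc; _+_; _*_; _≤_; z≤n; s≤s)
open import Data.Nat.ListAction using (sum)
open import Data.Nat.ListAction.Properties using (sum-++)
open import Data.Nat.Properties
open import Algebra.Properties.CommutativeSemigroup +-commutativeSemigroup
  using (interchange; x∙yz≈y∙xz)
open import Data.Nat.Tactic.RingSolver using (solve-∀)
open import Data.Product using (∃-syntax; _×_; _,_; proj₁; proj₂)
open import Data.Sum using (_⊎_; inj₁; inj₂; [_,_]′; reduce)
open import Function using (_∘_)
open import Function.Bundles using (Bijection)
open import Function.Properties.Bijection using (sym-≡)
open import Relation.Binary.PropositionalEquality
  using (_≡_; refl; sym; trans; cong; cong₂; subst)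

private
  variable
    n : ℕ
    a γ : GType
    Γ : List GType

∈⇒≤sum-map : ∀ {A : Set} (f : A → ℕ) {x xs} → x ∈ xs → f x ≤ sum (map f xs)
∈⇒≤sum-map f (here refl)           = m≤m+n _ _
∈⇒≤sum-map f {xs = y ∷ _} (there m) = ≤-trans (∈⇒≤sum-map f m) (m≤n+m _ (f y))

sum-map-≤-length* : ∀ {A : Set} (f : A → ℕ) {B} xs →
  (∀ {x} → x ∈ xs → f x ≤ B) → sum (map f xs) ≤ length xs * B
sum-map-≤-length* f []       _     = z≤n
sum-map-≤-length* f (x ∷ xs) bound =
  +-mono-≤ (bound (here refl)) (sum-map-≤-length* f xs (bound ∘ there))

sum-map-++ : ∀ {A : Set} (f : A → ℕ) xs ys →
  sum (map f (xs ++ ys)) ≡ sum (map f xs) + sum (map f ys)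
sum-map-++ f xs ys = trans (cong sum (map-++ f xs ys)) (sum-++ (map f xs) (map f ys))

components : GType → List GType
components unit    = []
components (a ⊕ b) = a ∷ b ∷ []
components (a ⊗ b) = a ∷ b ∷ []
components (μ P)   = app P (μ P) ∷ []

closure  : GType → List GType
-- closureP Q X: the types met below app Q X before reaching X itself
closureP : Poly → GType → List GType
closure unit      = unit ∷ []
closure (a ⊕ b)   = (a ⊕ b) ∷ closure a ++ closure b
closure (a ⊗ b)   = (a ⊗ b) ∷ closure a ++ closure b
closure (μ P)     = μ P ∷ closureP P (μ P)
closureP Id      X = X ∷ []
closureP (C γ)   X = closure γ
closureP (P ⊞ Q) X = app (P ⊞ Q) X ∷ closureP P X ++ closureP Q X
closureP (P ⊠ Q) X = app (P ⊠ Q) X ∷ closureP P X ++ closureP Q X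

∈-closure : ∀ γ → γ ∈ closure γ
∈-closure unit    = here refl
∈-closure (_ ⊕ _) = here refl
∈-closure (_ ⊗ _) = here refl
∈-closure (μ _)   = here refl

app∈closureP : ∀ Q X → app Q X ∈ closureP Q X
app∈closureP Id      X = here refl
app∈closureP (C γ)   X = ∈-closure γ
app∈closureP (_ ⊞ _) X = here refl
app∈closureP (_ ⊠ _) X = here refl

ComponentsIn : List GType → List GType → Set
ComponentsIn xs zs = ∀ {t} → t ∈ xs → components t ⊆ zs

componentsIn-⊆ : ∀ {xs ys zs} → ys ⊆ zs → ComponentsIn xs ys → ComponentsIn xs zs
componentsIn-⊆ ys⊆zs closed t∈xs c∈ = ys⊆zs (closed t∈xs c∈)

∷++-componentsIn : ∀ {t a b xs ys zs} → components t ≡ a ∷ b ∷ [] →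
  t ∷ xs ++ ys ⊆ zs → a ∈ xs → b ∈ ys →
  ComponentsIn xs zs → ComponentsIn ys zs → ComponentsIn (t ∷ xs ++ ys) zs
∷++-componentsIn {zs = zs} eq sub a∈ b∈ _ _ (here refl) =
  subst (_⊆ zs) (sym eq)
    (∈-∷⁺ʳ (sub (there (++⁺ˡ a∈))) (∈-∷⁺ʳ (sub (there (++⁺ʳ _ b∈))) λ ()))
∷++-componentsIn {xs = xs} _ _ _ _ closedˡ closedʳ (there t∈) =
  [ closedˡ , closedʳ ]′ (++⁻ xs t∈)

closure-closed  : ∀ γ → ComponentsIn (closure γ) (closure γ)
closureP-closed : ∀ Q P →
  ComponentsIn (closureP Q (μ P)) (closureP Q (μ P) ++ closureP P (μ P))

∷++-closure-closed : ∀ {t} a b → components t ≡ a ∷ b ∷ [] →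
  ComponentsIn (t ∷ closure a ++ closure b) (t ∷ closure a ++ closure b)
∷++-closure-closed a b eq =
  ∷++-componentsIn eq (λ m → m) (∈-closure a) (∈-closure b)
    (componentsIn-⊆ (λ m → there (++⁺ˡ m)) (closure-closed a))
    (componentsIn-⊆ (λ m → there (++⁺ʳ (closure a) m)) (closure-closed b))

∷++-closureP-closed : ∀ {t} Q R P →
  components t ≡ app Q (μ P) ∷ app R (μ P) ∷ [] →
  let xs = t ∷ closureP Q (μ P) ++ closureP R (μ P)
  in  ComponentsIn xs (xs ++ closureP P (μ P))
∷++-closureP-closed Q R P eq =
  ∷++-componentsIn eq ++⁺ˡ (app∈closureP Q (μ P)) (app∈closureP R (μ P))
    (componentsIn-⊆ (⊆-++⁺ˡ W (λ m → there (++⁺ˡ m))) (closureP-closed Q P))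
    (componentsIn-⊆ (⊆-++⁺ˡ W (λ m → there (++⁺ʳ (closureP Q (μ P)) m)))
      (closureP-closed R P))
  where W = closureP P (μ P)

closure-closed unit    (here refl) = λ ()
closure-closed (a ⊕ b) = ∷++-closure-closed a b refl
closure-closed (a ⊗ b) = ∷++-closure-closed a b refl
closure-closed (μ P)   (here refl) = ∈-∷⁺ʳ (there (app∈closureP P (μ P))) λ ()
closure-closed (μ P)   (there t∈) c∈ = there (reduce (++⁻ _ (closureP-closed P P t∈ c∈)))
closureP-closed Id      P (here refl) = ∈-∷⁺ʳ (++⁺ʳ (μ P ∷ []) (app∈closureP P (μ P))) λ ()
closureP-closed (C γ)   P = componentsIn-⊆ ++⁺ˡ (closure-closed γ)
closureP-closed (Q ⊞ R) P = ∷++-closureP-closed Q R P refl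
closureP-closed (Q ⊠ R) P = ∷++-closureP-closed Q R P refl

infoType : Info n → GType
infoType iU           = unit
infoType (iL a b _)   = a ⊕ b
infoType (iR a b _)   = a ⊕ b
infoType (iP a b _ _) = a ⊗ b
infoType (iC P _)     = μ P

infoType-shift : (i : Info n) → infoType (shiftInfo i) ≡ infoType i
infoType-shift iU           = refl
infoType-shift (iL _ _ _)   = refl
infoType-shift (iR _ _ _)   = refl
infoType-shift (iP _ _ _ _) = refl
infoType-shift (iC _ _)     = refl

infoType-node : (x : Node Γ γ) → infoType (nodeInfo₀ x) ≡ γ
infoType-node nUnit       = refl
infoType-node (nInl _)    = refl
infoType-node (nInr _)    = refl
infoType-node (nPair _ _) = refl
infoType-node (nCon _)    = refl

infoType-nodeInfo : (g : Graph Γ) (u : Fin (length Γ)) →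
  infoType (nodeInfo g u) ≡ lookup Γ u
infoType-nodeInfo (g ▷ x) zero    = trans (infoType-shift (nodeInfo₀ x)) (infoType-node x)
infoType-nodeInfo (g ▷ x) (suc u) = trans (infoType-shift (nodeInfo g u)) (infoType-nodeInfo g u)

children-shift : (i : Info n) → children (shiftInfo i) ≡ map suc (children i)
children-shift iU           = refl
children-shift (iL _ _ _)   = refl
children-shift (iR _ _ _)   = refl
children-shift (iP _ _ _ _) = refl
children-shift (iC _ _)     = refl

∈-children-shift⁻ : (i : Info n) {w : Fin (suc n)} →
  w ∈ children (shiftInfo i) → ∃[ w′ ] w′ ∈ children i × w ≡ suc w′
∈-children-shift⁻ i {w} w∈ = ∈-map⁻ suc (subst (w ∈_) (children-shift i) w∈)

node-children-types : (x : Node Γ γ) {w : Fin (length Γ)} →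
  w ∈ children (nodeInfo₀ x) → lookup Γ w ∈ components γ
node-children-types (nInl p)    (here refl)         = here (sym (lookup-index p))
node-children-types (nInr p)    (here refl)         = there (here (sym (lookup-index p)))
node-children-types (nPair p _) (here refl)         = here (sym (lookup-index p))
node-children-types (nPair _ q) (there (here refl)) = there (here (sym (lookup-index q)))
node-children-types (nCon p)    (here refl)         = here (sym (lookup-index p))

children-types : (g : Graph Γ) (u : Fin (length Γ)) {w : Fin (length Γ)} →
  w ∈ children (nodeInfo g u) → lookup Γ w ∈ components (lookup Γ u)
children-types (g ▷ x) zero w∈ with ∈-children-shift⁻ (nodeInfo₀ x) w∈
... | _ , w∈′ , refl = node-children-types x w∈′
children-types (g ▷ x) (suc u) w∈ with ∈-children-shift⁻ (nodeInfo g u) w∈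
... | _ , w∈′ , refl = children-types g u w∈′

reach-type-∈ : (g : Graph Γ) {r w : Fin (length Γ)} {xs : List GType} →
  ComponentsIn xs xs → lookup Γ r ∈ xs → Reach g r w → lookup Γ w ∈ xs
reach-type-∈ g closed r∈ start       = r∈
reach-type-∈ g closed r∈ (step p w∈) =
  closed (reach-type-∈ g closed r∈ p) (children-types g _ w∈)

vertexType∈closure : (v : Value γ) (u : Fin (length (Value.ctx v))) →
  lookup (Value.ctx v) u ∈ closure γ
vertexType∈closure {γ} (value ctx g root rooted) u =
  reach-type-∈ g (closure-closed γ)
    (subst (_∈ closure γ) (lookup-index root) (∈-closure γ)) (rooted u)

dropZeros : List (Fin (suc n)) → List (Fin n)
dropZeros []           = []
dropZeros (zero ∷ rs)  = dropZeros rs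
dropZeros (suc i ∷ rs) = i ∷ dropZeros rs

sum-dropZeros≤ : (f : Fin (suc n) → ℕ) (rs : List (Fin (suc n))) →
  sum (map (f ∘ suc) (dropZeros rs)) ≤ sum (map f rs)
sum-dropZeros≤ f []           = ≤-refl
sum-dropZeros≤ f (zero ∷ rs)  = ≤-trans (sum-dropZeros≤ f rs) (m≤n+m _ _)
sum-dropZeros≤ f (suc i ∷ rs) = +-monoʳ-≤ (f (suc i)) (sum-dropZeros≤ f rs)

zero+sum-dropZeros≤ : (f : Fin (suc n) → ℕ) (rs : List (Fin (suc n))) → zero ∈ rs →
  f zero + sum (map (f ∘ suc) (dropZeros rs)) ≤ sum (map f rs)
zero+sum-dropZeros≤ f (_ ∷ rs)     (here refl) = +-monoʳ-≤ (f zero) (sum-dropZeros≤ f rs)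
zero+sum-dropZeros≤ f (zero ∷ rs)  (there z∈) = ≤-trans (zero+sum-dropZeros≤ f rs z∈) (m≤n+m _ _)
zero+sum-dropZeros≤ f (suc i ∷ rs) (there z∈) = begin
  f zero + (f (suc i) + sum (map (f ∘ suc) (dropZeros rs)))
    ≡⟨ x∙yz≈y∙xz (f zero) (f (suc i)) _ ⟩
  f (suc i) + (f zero + sum (map (f ∘ suc) (dropZeros rs)))
    ≤⟨ +-monoʳ-≤ (f (suc i)) (zero+sum-dropZeros≤ f rs z∈) ⟩
  f (suc i) + sum (map f rs) ∎
  where open ≤-Reasoning

Covers : Graph Γ → List (Fin (length Γ)) → Set
Covers g rs = ∀ w → Any (λ r → Reach g r w) rs

module _ {g : Graph Γ} {x : Node Γ γ} where

  reach-newest : ∀ {r} → Reach (g ▷ x) r zero → r ≡ zero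
  reach-newest start = refl
  reach-newest (step {zero} _ z∈) with ∈-children-shift⁻ (nodeInfo₀ x) z∈
  ... | _ , _ , ()
  reach-newest (step {suc u} _ z∈) with ∈-children-shift⁻ (nodeInfo g u) z∈
  ... | _ , _ , ()

  reach-▷ : ∀ {r w} → Reach (g ▷ x) r (suc w) →
    (∃[ r′ ] r ≡ suc r′ × Reach g r′ w)
      ⊎ (r ≡ zero × Any (λ c → Reach g c w) (children (nodeInfo₀ x)))
  reach-▷ start = inj₁ (_ , refl , start)
  reach-▷ (step {zero} p w∈) with ∈-children-shift⁻ (nodeInfo₀ x) w∈
  ... | _ , w∈′ , refl = inj₂ (reach-newest p , Any.map (λ { refl → start }) w∈′)
  reach-▷ (step {suc u} p w∈) with ∈-children-shift⁻ (nodeInfo g u) w∈ | reach-▷ p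
  ... | _ , w∈′ , refl | inj₁ (r′ , eq , q) = inj₁ (r′ , eq , step q w∈′)
  ... | _ , w∈′ , refl | inj₂ (eq , qs)     = inj₂ (eq , Any.map (λ q → step q w∈′) qs)

  newest∈roots : ∀ {rs} → Covers (g ▷ x) rs → zero ∈ rs
  newest∈roots cover = Any.map (sym ∘ reach-newest) (cover zero)

  covers-▷ : ∀ {rs} → Covers (g ▷ x) rs → Covers g (children (nodeInfo₀ x) ++ dropZeros rs)
  covers-▷ cover w = [ ++⁺ˡ , ++⁺ʳ _ ]′ (split _ (cover (suc w)))
    where
    split : ∀ rs → Any (λ r → Reach (g ▷ x) r (suc w)) rs →
      Any (λ c → Reach g c w) (children (nodeInfo₀ x)) ⊎ Any (λ r → Reach g r w) (dropZeros rs)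
    split (_ ∷ _) (here q) with reach-▷ q
    ... | inj₁ (_ , refl , q′) = inj₂ (here q′)
    ... | inj₂ (_ , qs)        = inj₁ qs
    split (zero ∷ rs)  (there qs) = split rs qs
    split (suc _ ∷ rs) (there qs) = [ inj₁ , inj₂ ∘ there ]′ (split rs qs)

Weight : Set
Weight = ∀ {Γ γ} → Graph Γ → Node Γ γ → ℕ

total : Weight → Graph Γ → ℕ
total ω []      = 0
total ω (g ▷ x) = ω g x + total ω g

Rule : Set
Rule = ∀ {Γ γ} → (Fin (length Γ) → ℕ) → Node Γ γ → ℕ

attribute : Rule → (g : Graph Γ) → Fin (length Γ) → ℕ
attribute φ (g ▷ x) zero    = φ (attribute φ g) x
attribute φ (g ▷ x) (suc i) = attribute φ g i

-- The newest vertex is a source, hence a root; removing it, its children become roots.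
module _ (ω ε : Weight) (φ : Rule)
  (local-bound : ∀ {Γ γ} (g : Graph Γ) (x : Node Γ γ) →
     ω g x + sum (map (attribute φ g) (children (nodeInfo₀ x))) ≤ φ (attribute φ g) x + ε g x)
  where

  total≤roots+total : (g : Graph Γ) (rs : List (Fin (length Γ))) → Covers g rs →
    total ω g ≤ sum (map (attribute φ g) rs) + total ε g
  total≤roots+total []      rs _     = z≤n
  total≤roots+total (g ▷ x) rs cover = begin
    ω g x + total ω g
      ≤⟨ +-monoʳ-≤ (ω g x) (total≤roots+total g (kids ++ rest) (covers-▷ cover)) ⟩
    ω g x + (sum (map F (kids ++ rest)) + total ε g)
      ≡⟨ cong (λ s → ω g x + (s + total ε g)) (sum-map-++ F kids rest) ⟩
    ω g x + (sum (map F kids) + sum (map F rest) + total ε g)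
      ≡⟨ cong (ω g x +_) (+-assoc (sum (map F kids)) _ _) ⟩
    ω g x + (sum (map F kids) + (sum (map F rest) + total ε g))
      ≡⟨ sym (+-assoc (ω g x) _ _) ⟩
    ω g x + sum (map F kids) + (sum (map F rest) + total ε g)
      ≤⟨ +-monoˡ-≤ _ (local-bound g x) ⟩
    φ F x + ε g x + (sum (map F rest) + total ε g)
      ≡⟨ interchange (φ F x) (ε g x) _ _ ⟩
    φ F x + sum (map F rest) + (ε g x + total ε g)
      ≤⟨ +-monoˡ-≤ _ (zero+sum-dropZeros≤ (attribute φ (g ▷ x)) rs (newest∈roots cover)) ⟩
    sum (map (attribute φ (g ▷ x)) rs) + total ε (g ▷ x) ∎
    where
    open ≤-Reasoning
    F    = attribute φ g
    kids = children (nodeInfo₀ x)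
    rest = dropZeros rs

rooted-covers : (v : Value γ) → Covers (Value.graph v) (index (Value.root v) ∷ [])
rooted-covers v w = here (Value.rooted v w)

pair-sum : ∀ c d → c + (d + 0) ≡ c + d + 0
pair-sum c d = trans (cong (c +_) (+-identityʳ d)) (sym (+-identityʳ (c + d)))

conV : Val γ → ℕ
conV ⟨⟩         = 0
conV (inl v)    = conV v
conV (inr v)    = conV v
conV (pair u v) = conV u + conV v
conV (con v)    = suc (conV v)

isCon : Weight
isCon _ (nCon _) = 1
isCon _ _        = 0

noWeight : Weight
noWeight _ _ = 0

treeCons : Rule
treeCons val nUnit       = 0
treeCons val (nInl p)    = val (index p)
treeCons val (nInr p)    = val (index p)
treeCons val (nPair p q) = val (index p) + val (index q)
treeCons val (nCon p)    = suc (val (index p))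

treeCons-local : (g : Graph Γ) (x : Node Γ γ) →
  isCon g x + sum (map (attribute treeCons g) (children (nodeInfo₀ x)))
    ≤ treeCons (attribute treeCons g) x + noWeight g x
treeCons-local g nUnit       = ≤-refl
treeCons-local g (nInl _)    = ≤-refl
treeCons-local g (nInr _)    = ≤-refl
treeCons-local g (nPair p q) = ≤-reflexive (pair-sum (attribute treeCons g (index p)) _)
treeCons-local g (nCon _)    = ≤-refl

treeCons≡conV      : (g : Graph Γ) (p : a ∈ Γ) →
  attribute treeCons g (index p) ≡ conV (unfoldG g p)
treeCons≡conV-node : (g : Graph Γ) (x : Node Γ a) →
  treeCons (attribute treeCons g) x ≡ conV (unfoldNode g x)
treeCons≡conV (g ▷ x) (here refl) = treeCons≡conV-node g x
treeCons≡conV (g ▷ x) (there p)   = treeCons≡conV g p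
treeCons≡conV-node g nUnit       = refl
treeCons≡conV-node g (nInl p)    = treeCons≡conV g p
treeCons≡conV-node g (nInr p)    = treeCons≡conV g p
treeCons≡conV-node g (nPair p q) = cong₂ _+_ (treeCons≡conV g p) (treeCons≡conV g q)
treeCons≡conV-node g (nCon p)    = cong suc (treeCons≡conV g p)

sizeG≡total-isCon : (g : Graph Γ) → sizeG g ≡ total isCon g
sizeG≡total-isCon []              = refl
sizeG≡total-isCon (g ▷ nUnit)     = sizeG≡total-isCon g
sizeG≡total-isCon (g ▷ nInl _)    = sizeG≡total-isCon g
sizeG≡total-isCon (g ▷ nInr _)    = sizeG≡total-isCon g
sizeG≡total-isCon (g ▷ nPair _ _) = sizeG≡total-isCon g
sizeG≡total-isCon (g ▷ nCon _)    = cong suc (sizeG≡total-isCon g)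

total-noWeight : (g : Graph Γ) → total noWeight g ≡ 0
total-noWeight []      = refl
total-noWeight (g ▷ _) = total-noWeight g

size≤conV-unfold : (v : Value γ) → size v ≤ conV (unfoldV v)
size≤conV-unfold v@(value _ g root _) = begin
  sizeG g
    ≡⟨ sizeG≡total-isCon g ⟩
  total isCon g
    ≤⟨ total≤roots+total isCon noWeight treeCons treeCons-local g _ (rooted-covers v) ⟩
  attribute treeCons g (index root) + 0 + total noWeight g
    ≡⟨ cong₂ _+_ (+-identityʳ _) (total-noWeight g) ⟩
  attribute treeCons g (index root) + 0
    ≡⟨ trans (+-identityʳ _) (treeCons≡conV g root) ⟩
  conV (unfoldV v) ∎
  where open ≤-Reasoning

shallowSize : GType → ℕ
shallowSize unit    = 1
shallowSize (a ⊕ b) = suc (shallowSize a + shallowSize b)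
shallowSize (a ⊗ b) = suc (shallowSize a + shallowSize b)
shallowSize (μ _)   = 1

-- size of the unfolding below a vertex, cut off at (and counting) constructor vertices
shallowCount : Rule
shallowCount val nUnit       = 1
shallowCount val (nInl p)    = suc (val (index p))
shallowCount val (nInr p)    = suc (val (index p))
shallowCount val (nPair p q) = suc (val (index p) + val (index q))
shallowCount val (nCon _)    = 1

one : Weight
one _ _ = 1

-- each constructor vertex pays for the shallow unfolding of its child
conChildCount : Weight
conChildCount g (nCon p) = attribute shallowCount g (index p)
conChildCount _ _        = 0

shallowCount-local : (g : Graph Γ) (x : Node Γ γ) →
  one g x + sum (map (attribute shallowCount g) (children (nodeInfo₀ x)))
    ≤ shallowCount (attribute shallowCount g) x + conChildCount g x
shallowCount-local g nUnit       = ≤-refl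
shallowCount-local g (nInl _)    = ≤-refl
shallowCount-local g (nInr _)    = ≤-refl
shallowCount-local g (nPair p _) =
  s≤s (≤-reflexive (pair-sum (attribute shallowCount g (index p)) _))
shallowCount-local g (nCon _)    = s≤s (≤-reflexive (+-identityʳ _))

shallowCount≤shallowSize   : (g : Graph Γ) (u : Fin (length Γ)) →
  attribute shallowCount g u ≤ shallowSize (lookup Γ u)
shallowCount≤shallowSize-∈ : (g : Graph Γ) (p : a ∈ Γ) →
  attribute shallowCount g (index p) ≤ shallowSize a
shallowCount≤shallowSize-∈ g p =
  subst (λ t → attribute shallowCount g (index p) ≤ shallowSize t) (sym (lookup-index p))
    (shallowCount≤shallowSize g (index p))
shallowCount≤shallowSize (g ▷ x)         (suc u) = shallowCount≤shallowSize g u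
shallowCount≤shallowSize (g ▷ nUnit)     zero    = ≤-refl
shallowCount≤shallowSize (g ▷ nInl p)    zero    =
  s≤s (≤-trans (shallowCount≤shallowSize-∈ g p) (m≤m+n _ _))
shallowCount≤shallowSize (g ▷ nInr p)    zero    =
  s≤s (≤-trans (shallowCount≤shallowSize-∈ g p) (m≤n+m _ _))
shallowCount≤shallowSize (g ▷ nPair p q) zero    =
  s≤s (+-mono-≤ (shallowCount≤shallowSize-∈ g p) (shallowCount≤shallowSize-∈ g q))
shallowCount≤shallowSize (g ▷ nCon _)    zero    = ≤-refl

total-one : (g : Graph Γ) → total one g ≡ length Γ
total-one []      = refl
total-one (g ▷ _) = cong suc (total-one g)

total-conChildCount≤ : ∀ {K} (g : Graph Γ) → (∀ u → attribute shallowCount g u ≤ K) →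
  total conChildCount g ≤ K * sizeG g
total-conChildCount≤         []              _     = z≤n
total-conChildCount≤         (g ▷ nUnit)     bound = total-conChildCount≤ g (bound ∘ suc)
total-conChildCount≤         (g ▷ nInl _)    bound = total-conChildCount≤ g (bound ∘ suc)
total-conChildCount≤         (g ▷ nInr _)    bound = total-conChildCount≤ g (bound ∘ suc)
total-conChildCount≤         (g ▷ nPair _ _) bound = total-conChildCount≤ g (bound ∘ suc)
total-conChildCount≤ {K = K} (g ▷ nCon p)    bound =
  ≤-trans (+-mono-≤ (bound (suc (index p))) (total-conChildCount≤ g (bound ∘ suc)))
    (≤-reflexive (sym (*-suc K (sizeG g))))

vertexCount≤ : ∀ {K} (v : Value γ) → (∀ u → shallowSize (lookup (Value.ctx v) u) ≤ K) →
  length (Value.ctx v) ≤ K * suc (size v)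
vertexCount≤ {K = K} v@(value ctx g root _) bound = begin
  length ctx
    ≡⟨ sym (total-one g) ⟩
  total one g
    ≤⟨ total≤roots+total one conChildCount shallowCount shallowCount-local g _ (rooted-covers v) ⟩
  attribute shallowCount g (index root) + 0 + total conChildCount g
    ≤⟨ +-mono-≤ (+-monoˡ-≤ 0 (shallow≤K (index root))) (total-conChildCount≤ g shallow≤K) ⟩
  K + 0 + K * sizeG g
    ≡⟨ trans (cong (_+ K * sizeG g) (+-identityʳ K)) (sym (*-suc K (sizeG g))) ⟩
  K * suc (sizeG g) ∎
  where
  open ≤-Reasoning
  shallow≤K : ∀ u → attribute shallowCount g u ≤ K
  shallow≤K u = ≤-trans (shallowCount≤shallowSize g u) (bound u)

itemCost : ∀ {k} → Item k → ℕ
itemCost vUnit         = 1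
itemCost (vInl s a)    = suc (conV s + suc a)
itemCost (vInr s a)    = suc (conV s + suc a)
itemCost (vPair s a b) = suc (conV s + (suc a + suc b))
itemCost (vMu s a)     = suc (conV s + suc a)

conV-nat : (a : Val natT) → conV a ≡ suc (toNat a)
conV-nat (con (inl ⟨⟩)) = refl
conV-nat (con (inr a))  = cong suc (conV-nat a)

conV-vertex : ∀ {k} (x : Val (vertexT k)) → conV x ≡ itemCost (toItem x)
conV-vertex (con (inl ⟨⟩)) = refl
conV-vertex (con (inr (inl (pair s a)))) =
  cong (λ z → suc (conV s + z)) (conV-nat a)
conV-vertex (con (inr (inr (inl (pair s a))))) =
  cong (λ z → suc (conV s + z)) (conV-nat a)
conV-vertex (con (inr (inr (inr (inl (pair s (pair a b))))))) =
  cong (λ z → suc (conV s + z)) (cong₂ _+_ (conV-nat a) (conV-nat b))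
conV-vertex (con (inr (inr (inr (inr (pair s a)))))) =
  cong (λ z → suc (conV s + z)) (conV-nat a)

conV-list : ∀ {α} (xs : Val (listT α)) → conV xs ≡ suc (sum (map (suc ∘ conV) (toList xs)))
conV-list (con (inl ⟨⟩))          = refl
conV-list (con (inr (pair x xs))) =
  cong suc (trans (cong (conV x +_) (conV-list xs)) (+-suc (conV x) _))

size≤items : ∀ {k B} (L : Value (vtgT k)) → (∀ {it} → it ∈ itemsByAddr L → itemCost it ≤ B) →
  size L ≤ suc (length (itemsByAddr L) * suc B)
size≤items {B = B} L bound = begin
  size L
    ≤⟨ size≤conV-unfold L ⟩
  conV (unfoldV L)
    ≡⟨ conV-list (unfoldV L) ⟩
  suc (sum (map (suc ∘ conV) xs))
    ≤⟨ s≤s (sum-map-≤-length* (suc ∘ conV) xs (s≤s ∘ cost)) ⟩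
  suc (length xs * suc B)
    ≡⟨ cong (λ l → suc (l * suc B)) (sym length-items) ⟩
  suc (length (itemsByAddr L) * suc B) ∎
  where
  open ≤-Reasoning
  xs = toList (unfoldV L)
  cost : ∀ {x} → x ∈ xs → conV x ≤ B
  cost {x} x∈ = subst (_≤ B) (sym (conV-vertex x)) (bound (reverse⁺ (∈-map⁺ toItem x∈)))
  length-items : length (itemsByAddr L) ≡ length xs
  length-items = trans (length-reverse (map toItem xs)) (length-map toItem xs)

suc-toℕ≤n+n : ∀ {m} (i : Fin m) → suc (toℕ i) ≤ m + m
suc-toℕ≤n+n {m} i = ≤-trans (toℕ<n i) (m≤m+n m m)

itemCost-expected : ∀ {k m E} (enc : GType → Val (stringT k)) (f : Fin n → Fin m)
  (i : Info n) → conV (enc (infoType i)) ≤ E → itemCost (expected enc f i) ≤ suc (E + (m + m))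
itemCost-expected enc f iU           _  = s≤s z≤n
itemCost-expected enc f (iL _ _ c)   hE = s≤s (+-mono-≤ hE (suc-toℕ≤n+n (f c)))
itemCost-expected enc f (iR _ _ c)   hE = s≤s (+-mono-≤ hE (suc-toℕ≤n+n (f c)))
itemCost-expected enc f (iP _ _ c d) hE = s≤s (+-mono-≤ hE (+-mono-≤ (toℕ<n (f c)) (toℕ<n (f d))))
itemCost-expected enc f (iC _ c)     hE = s≤s (+-mono-≤ hE (suc-toℕ≤n+n (f c)))

module _ {k} (enc : GType → Val (stringT k)) (v : Value γ) (L : Value (vtgT k)) where

  represents-length : Represents k enc v L → length (itemsByAddr L) ≤ length (Value.ctx v)
  represents-length (β , _) = injective⇒≤ (Bijection.injective (sym-≡ β))

  represents-items : (rep : Represents k enc v L) → ∀ {it} → it ∈ itemsByAddr L →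
    ∃[ w ] it ≡ expected enc (Bijection.to (proj₁ rep)) (nodeInfo (Value.graph v) w)
  represents-items (β , items-at , _) {it} it∈ = w , (begin
    it                                 ≡⟨ lookup-index it∈ ⟩
    lookup (itemsByAddr L) (index it∈) ≡⟨ cong (lookup (itemsByAddr L)) (sym (to-w refl)) ⟩
    lookup (itemsByAddr L) (to w)      ≡⟨ items-at w ⟩
    expected enc to (nodeInfo (Value.graph v) w) ∎)
    where
    open Bijection β using (to; surjective)
    open Relation.Binary.PropositionalEquality.≡-Reasoning
    w   = proj₁ (surjective (index it∈))
    to-w = proj₂ (surjective (index it∈))

quadratic : ∀ K E s → suc (K * suc s * (2 + E + (K * suc s + K * suc s)))
  ≡ 2 * K * K * (s * s) + (K * (2 + E) + 4 * K * K) * s + suc (K * (2 + E) + 2 * K * K)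
quadratic = solve-∀

lemma15 : (k : ℕ) (enc : GType → Val (stringT k)) (γ : GType) →
    ∃[ a ] ∃[ b ] ∃[ c ] (∀ (v : Value γ) (L : Value (vtgT k)) →
      Represents k enc v L →
      size L ≤ a * (size v * size v) + b * size v + c)
lemma15 k enc γ = 2 * K * K , K * (2 + E) + 4 * K * K , suc (K * (2 + E) + 2 * K * K) , bound
  where
  K = sum (map shallowSize (closure γ))
  E = sum (map (conV ∘ enc) (closure γ))
  bound : ∀ v L → Represents k enc v L →
    size L ≤ 2 * K * K * (size v * size v) + (K * (2 + E) + 4 * K * K) * size v
               + suc (K * (2 + E) + 2 * K * K)
  bound v L rep = begin
    size L                          ≤⟨ size≤items L item-cost ⟩
    suc (m * (2 + E + (m + m)))  ≤⟨ s≤s (*-mono-≤ m≤N (+-monoʳ-≤ (2 + E) (+-mono-≤ m≤N m≤N))) ⟩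
    suc (N * (2 + E + (N + N)))  ≡⟨ quadratic K E (size v) ⟩
    _                            ∎
    where
    open ≤-Reasoning
    m = length (itemsByAddr L)
    N = K * suc (size v)
    m≤N : m ≤ N
    m≤N = ≤-trans (represents-length enc v L rep)
      (vertexCount≤ v (λ u → ∈⇒≤sum-map shallowSize (vertexType∈closure v u)))
    item-cost : ∀ {it} → it ∈ itemsByAddr L → itemCost it ≤ suc (E + (m + m))
    item-cost it∈ with represents-items enc v L rep it∈
    ... | w , refl = itemCost-expected enc _ (nodeInfo (Value.graph v) w)
      (subst (λ t → conV (enc t) ≤ E) (sym (infoType-nodeInfo (Value.graph v) w))
        (∈⇒≤sum-map (conV ∘ enc) (vertexType∈closure v w)))
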